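{- Let $G$ be a $\{K_{1,3}, (K_2 \cup K_1) + K_2\}$-free graph, with $\Delta = \Delta(G)$ and $\omega = \omega(G)$. Then $\Delta \leq 2\omega - 1$, and either 1. $\Delta = 2\omega - 1$ with $\Delta = 5$ and $\omega = 3$; or 2. $\Delta \leq 2\omega - 2$.
   Context: All graphs are finite and simple. $\Delta(G)$ is the maximum degree of $G$ and $\omega(G)$ is the size of a maximum clique of $G$. $K_{1,3}$ is the claw. $(K_2 \cup K_1) + K_2$ denotes the join of $K_2 \cup K_1$ (an edge plus an isolated vertex) with $K_2$: vertices $a,b,c,d,e$ with edges $ab, de, ad, ae, bd, be, cd, ce$. A graph is $\{H_1, H_2\}$-free if it contains no induced subgraph isomorphic to $H_1$ or to $H_2$. -}

module Defs where

open import Data.Nat using (ℕ; _≤_; _≡ᵇ_)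
open import Data.Bool using (Bool; true; false; _∧_; _∨_)
open import Data.Fin using (Fin; toℕ)
open import Data.Fin.Subset using (Subset; _∈_; ∣_∣)
open import Data.List using (List; []; _∷_; length; filterᵇ)
open import Data.Bool.ListAction using (any)
open import Data.List using () renaming (allFin to allFinL)
open import Data.Product using (Σ; ∃; _×_; _,_)
open import Relation.Binary.PropositionalEquality using (_≡_; _≢_)
open import Relation.Nullary using (¬_)
open import Function.Definitions using (Injective)

record Graph (n : ℕ) : Set where
  field
    adj    : Fin n → Fin n → Bool
    sym    : ∀ i j → adj i j ≡ adj j i
    irrefl : ∀ i → adj i i ≡ false
open Graph public

degree : ∀ {n} → Graph n → Fin n → ℕ
degree {n} G v = length (filterᵇ (adj G v) (allFinL n))

IsMaxDegree : ∀ {n} → Graph n → ℕ → Set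
IsMaxDegree {n} G d =
  (Σ (Fin n) λ v → degree G v ≡ d) × (∀ v → degree G v ≤ d)

IsClique : ∀ {n} → Graph n → Subset n → Set
IsClique G p = ∀ i j → i ∈ p → j ∈ p → i ≢ j → adj G i j ≡ true

IsCliqueNumber : ∀ {n} → Graph n → ℕ → Set
IsCliqueNumber G w =
  (Σ _ λ p → IsClique G p × ∣ p ∣ ≡ w) × (∀ p → IsClique G p → ∣ p ∣ ≤ w)

adjFromEdges : ∀ {k} → List (ℕ × ℕ) → Fin k → Fin k → Bool
adjFromEdges es i j = any (λ { (a , b) →
  ((toℕ i ≡ᵇ a) ∧ (toℕ j ≡ᵇ b)) ∨ ((toℕ i ≡ᵇ b) ∧ (toℕ j ≡ᵇ a)) }) es

ContainsInduced : ∀ {k n} → (Fin k → Fin k → Bool) → Graph n → Set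
ContainsInduced {k} {n} h G =
  Σ (Fin k → Fin n) λ f → Injective _≡_ _≡_ f × (∀ i j → adj G (f i) (f j) ≡ h i j)

clawAdj : Fin 4 → Fin 4 → Bool
clawAdj = adjFromEdges ((0 , 1) ∷ (0 , 2) ∷ (0 , 3) ∷ [])

-- (K_2 ∪ K_1) + K_2 with a,b,c,d,e = 0,1,2,3,4;
-- edges ab, de, ad, ae, bd, be, cd, ce
k2k1joinK2Adj : Fin 5 → Fin 5 → Bool
k2k1joinK2Adj = adjFromEdges
  ((0 , 1) ∷ (3 , 4) ∷ (0 , 3) ∷ (0 , 4) ∷ (1 , 3) ∷ (1 , 4) ∷ (2 , 3) ∷ (2 , 4) ∷ [])

ClawK2K1K2Free : ∀ {n} → Graph n → Set
ClawK2K1K2Free G = ¬ ContainsInduced clawAdj G × ¬ ContainsInduced k2k1joinK2Adj G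

module Submission where

-- Let v have maximum degree and H = G[N(v)].  In a claw-free graph two
-- non-neighbours of a vertex of H are adjacent, and v extends every clique of
-- H, so cliques of H have at most ω − 1 vertices.  Take x ∈ H with the most
-- non-neighbours in H.  If the neighbours of x in H form a clique, H splits
-- into x, that clique and the clique of non-neighbours of x: |H| ≤ 2ω − 2.
-- If every vertex of H has at most one non-neighbour in H, H contains a
-- clique of half its size: again |H| ≤ 2ω − 2.  Otherwise x has two
-- non-adjacent neighbours and two non-neighbours in H; excluding
-- (K₂ ∪ K₁) + K₂, no neighbour of x in H sees two non-neighbours of x, and
-- with the maximality of x this forces H to be an induced 5-cycle, so Δ = 5
-- and ω ≥ 3.

open import Defs
open import Data.Nat using (ℕ; _≤_; _*_; _∸_; suc)
open import Data.Sum using (_⊎_)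
open import Data.Product using (_×_)
open import Relation.Binary.PropositionalEquality using (_≡_)

open import Data.Bool using (Bool; true; false; _∧_; _∨_; not; if_then_else_)
open import Data.Bool.Properties
  using (∧-zeroʳ; ∧-identityʳ; ∧-conicalˡ; ∧-conicalʳ; not-injective; ¬-not; not-¬)
  renaming (_≟_ to _≟ᵇ_)
open import Data.Empty using (⊥; ⊥-elim)
open import Data.Fin using (Fin; zero; suc) renaming (_<_ to _<ᶠ_)
open import Data.Fin.Properties using (_≟_; <-cmp; any?; all?; suc-injective)
import Data.Fin.Subset as Subset
open import Data.List using (List; []; _∷_; length; filterᵇ; tabulate)
open import Data.List.Membership.Propositional using (_∈_)
open import Data.List.Relation.Unary.All as All using (All; []; _∷_)
open import Data.List.Relation.Unary.Any as Any using (here; there)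
open import Data.List.Relation.Unary.Unique.Propositional using (Unique; []; _∷_)
open import Data.Nat using (zero; _+_; z≤n; s≤s)
open import Data.Nat.Properties
  using (≤-refl; ≤-trans; ≤-reflexive; ≤-pred; +-mono-≤; +-suc; m≤m+n; m≤n⇒m≤1+n; n≤1+n;
         m+n≤o⇒m≤o∸n; ∸-monoʳ-≤; ≤∧≢⇒<; ≰⇒>; _≤?_; <⇒≤; *-monoʳ-≤; module ≤-Reasoning)
  renaming (_≟_ to _≟ℕ_)
open import Data.Nat.Tactic.RingSolver using (solve-∀)
open import Data.Product using (∃; ∃₂; _,_; proj₁; proj₂)
open import Data.Sum using (inj₁; inj₂)
open import Data.Vec using ([]; _∷_; lookup)
import Data.Vec as Vec
open import Data.Vec.Properties using (lookup∘tabulate; []=⇒lookup)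
open import Function using (_∘_)
open import Function.Definitions using (Injective)
open import Relation.Binary.Definitions using (tri<; tri≈; tri>)
open import Relation.Binary.PropositionalEquality
  using (_≢_; refl; trans; cong; cong₂; subst; ≢-sym; module ≡-Reasoning)
  renaming (sym to ≡-sym)
open import Relation.Nullary using (¬_; yes; no; contradiction)
open import Relation.Nullary.Decidable using (⌊_⌋; ¬?; _×-dec_; from-yes)

-- Vertex sets as Boolean predicates

module _ {m : ℕ} where

  infixl 6 _∩_ _∖_ _-_
  infix 4 _⊆_

  ∅ : Fin m → Bool
  ∅ _ = false

  _∩_ _∖_ : (Fin m → Bool) → (Fin m → Bool) → Fin m → Bool
  (P ∩ Q) i = P i ∧ Q i
  (P ∖ Q) i = P i ∧ not (Q i)

  _-_ : (Fin m → Bool) → Fin m → Fin m → Bool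
  (P - a) i = P i ∧ not ⌊ i ≟ a ⌋

  insert : Fin m → (Fin m → Bool) → Fin m → Bool
  insert a P i = ⌊ i ≟ a ⌋ ∨ P i

  _⊆_ : (Fin m → Bool) → (Fin m → Bool) → Set
  P ⊆ Q = ∀ i → P i ≡ true → Q i ≡ true

  ∩-intro : ∀ P Q {i : Fin m} → P i ≡ true → Q i ≡ true → (P ∩ Q) i ≡ true
  ∩-intro _ _ p q = cong₂ _∧_ p q

  P∩Q⊆P : ∀ P Q → P ∩ Q ⊆ P
  P∩Q⊆P _ _ _ = ∧-conicalˡ _ _

  P∩Q⊆Q : ∀ P Q → P ∩ Q ⊆ Q
  P∩Q⊆Q _ _ _ = ∧-conicalʳ _ _

  ∖-intro : ∀ P Q {i : Fin m} → P i ≡ true → Q i ≡ false → (P ∖ Q) i ≡ true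
  ∖-intro _ _ p q = cong₂ _∧_ p (cong not q)

  ∖-elim : ∀ P Q {i : Fin m} → (P ∖ Q) i ≡ true → P i ≡ true × Q i ≡ false
  ∖-elim _ _ e = ∧-conicalˡ _ _ e , not-injective (∧-conicalʳ _ _ e)

  -intro : ∀ P {a i : Fin m} → P i ≡ true → i ≢ a → (P - a) i ≡ true
  -intro P {a} {i} Pi i≢a with i ≟ a
  ... | yes i≡a = contradiction i≡a i≢a
  ... | no _    = trans (∧-identityʳ (P i)) Pi

  -elim : ∀ P {a i : Fin m} → (P - a) i ≡ true → P i ≡ true × i ≢ a
  -elim P {a} {i} e with i ≟ a
  ... | yes _   = contradiction (trans (≡-sym (∧-zeroʳ (P i))) e) λ ()
  ... | no i≢a  = trans (≡-sym (∧-identityʳ (P i))) e , i≢a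

  ⊆-trans : ∀ {P Q R : Fin m → Bool} → P ⊆ Q → Q ⊆ R → P ⊆ R
  ⊆-trans P⊆Q Q⊆R i = Q⊆R i ∘ P⊆Q i

  insert⊆ : ∀ {P Q : Fin m → Bool} {a} → Q a ≡ true → P ⊆ Q → insert a P ⊆ Q
  insert⊆ {a = a} Qa P⊆Q i e with i ≟ a
  ... | yes refl = Qa
  ... | no _     = P⊆Q i e

  -∖-mono : ∀ {P Q R : Fin m → Bool} {a} → P ⊆ Q → P - a ∖ R ⊆ Q - a ∖ R
  -∖-mono {P} P⊆Q i e with P i in Pi
  ... | true rewrite P⊆Q i Pi = e
  ... | false = contradiction e λ ()

count : ∀ {m} → (Fin m → Bool) → ℕ
count {zero}  P = 0
count {suc m} P = (if P zero then 1 else 0) + count (λ i → P (suc i))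

count-cong : ∀ {m} {P Q : Fin m → Bool} → (∀ i → P i ≡ Q i) → count P ≡ count Q
count-cong {zero}  _   = refl
count-cong {suc m} P≗Q =
  cong₂ _+_ (cong (λ b → if b then 1 else 0) (P≗Q zero)) (count-cong (λ i → P≗Q (suc i)))

count-none : ∀ {m} {P : Fin m → Bool} → (∀ i → P i ≡ false) → count P ≡ 0
count-none {zero}  _    = refl
count-none {suc m} none rewrite none zero = count-none (λ i → none (suc i))

count-mono : ∀ {m} {P Q : Fin m → Bool} → P ⊆ Q → count P ≤ count Q
count-mono {zero}          _   = z≤n
count-mono {suc m} {P} {Q} P⊆Q with P zero in Pz | Q zero in Qz
... | true  | true  = s≤s (count-mono (λ i → P⊆Q (suc i)))
... | true  | false = contradiction (trans (≡-sym (P⊆Q zero Pz)) Qz) λ ()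
... | false | true  = m≤n⇒m≤1+n (count-mono (λ i → P⊆Q (suc i)))
... | false | false = count-mono (λ i → P⊆Q (suc i))

count-split : ∀ {m} (P Q : Fin m → Bool) → count P ≡ count (P ∩ Q) + count (P ∖ Q)
count-split {zero}  _ _ = refl
count-split {suc m} P Q with P zero | Q zero
... | true  | true  = cong suc (count-split (λ i → P (suc i)) (λ i → Q (suc i)))
... | true  | false =
  trans (cong suc (count-split (λ i → P (suc i)) (λ i → Q (suc i)))) (≡-sym (+-suc _ _))
... | false | _     = count-split (λ i → P (suc i)) (λ i → Q (suc i))

count-≡suc : ∀ {m} {P Q : Fin m → Bool} {a} → P a ≡ true → Q a ≡ false →
  (∀ i → i ≢ a → P i ≡ Q i) → count P ≡ suc (count Q)
count-≡suc {suc m} {a = zero} Pa Qa agree rewrite Pa | Qa =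
  cong suc (count-cong (λ i → agree (suc i) λ ()))
count-≡suc {suc m} {P} {Q} {suc a} Pa Qa agree rewrite agree zero (λ ()) =
  trans (cong ((if Q zero then 1 else 0) +_)
              (count-≡suc Pa Qa λ i i≢a → agree (suc i) (i≢a ∘ suc-injective)))
        (+-suc _ _)

count-remove : ∀ {m} (P : Fin m → Bool) {a} → P a ≡ true → count P ≡ suc (count (P - a))
count-remove P {a} Pa = count-≡suc Pa removed (λ i i≢a → ≡-sym (-intro′ i i≢a))
  where
  removed : (P - a) a ≡ false
  removed with a ≟ a
  ... | yes _   = ∧-zeroʳ (P a)
  ... | no a≢a  = contradiction refl a≢a
  -intro′ : ∀ i → i ≢ a → (P - a) i ≡ P i
  -intro′ i i≢a with i ≟ a
  ... | yes i≡a = contradiction i≡a i≢a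
  ... | no _    = ∧-identityʳ (P i)

count-insert : ∀ {m} (P : Fin m → Bool) {a} → P a ≡ false → count (insert a P) ≡ suc (count P)
count-insert P {a} Pa = count-≡suc inserted Pa kept
  where
  inserted : insert a P a ≡ true
  inserted with a ≟ a
  ... | yes _  = refl
  ... | no a≢a = contradiction refl a≢a
  kept : ∀ i → i ≢ a → insert a P i ≡ P i
  kept i i≢a with i ≟ a
  ... | yes i≡a = contradiction i≡a i≢a
  ... | no _    = refl

member-or-count≡0 : ∀ {m} (P : Fin m → Bool) → (∃ λ a → P a ≡ true) ⊎ count P ≡ 0
member-or-count≡0 {zero}  P = inj₂ refl
member-or-count≡0 {suc m} P with P zero in Pz
... | true  = inj₁ (zero , Pz)
... | false with member-or-count≡0 (λ i → P (suc i))
...   | inj₁ (a , Pa) = inj₁ (suc a , Pa)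
...   | inj₂ none     = inj₂ none

2≤count⇒pair : ∀ {m} {P : Fin m → Bool} → 2 ≤ count P →
  ∃₂ λ a b → P a ≡ true × P b ≡ true × a ≢ b
2≤count⇒pair {P = P} 2≤ with member-or-count≡0 P
... | inj₂ none = contradiction (subst (2 ≤_) none 2≤) λ ()
... | inj₁ (a , Pa) with member-or-count≡0 (P - a)
...   | inj₂ none =
  contradiction (subst (2 ≤_) (trans (count-remove P Pa) (cong suc none)) 2≤) λ { (s≤s ()) }
...   | inj₁ (b , P-a-b) = a , b , Pa , proj₁ (-elim P P-a-b) , ≢-sym (proj₂ (-elim P P-a-b))

count≤length : ∀ {m} {P : Fin m → Bool} (xs : List (Fin m)) → (∀ i → P i ≡ true → i ∈ xs) →
  count P ≤ length xs
count≤length [] P⊆[] = ≤-reflexive (count-none λ i → ¬-not λ Pi → contradiction (P⊆[] i Pi) λ ())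
count≤length {P = P} (x ∷ xs) P⊆x∷xs with P x in Px
... | false = m≤n⇒m≤1+n (count≤length xs λ i Pi →
                Any.tail (λ { refl → contradiction (trans (≡-sym Pi) Px) λ () }) (P⊆x∷xs i Pi))
... | true  = ≤-trans (≤-reflexive (count-remove P Px)) (s≤s (count≤length xs λ i P-x-i →
                Any.tail (proj₂ (-elim P P-x-i)) (P⊆x∷xs i (proj₁ (-elim P P-x-i)))))

length≤count : ∀ {m} {P : Fin m → Bool} {xs : List (Fin m)} →
  Unique xs → All (λ i → P i ≡ true) xs → length xs ≤ count P
length≤count [] [] = z≤n
length≤count {P = P} (x∉xs ∷ unique) (Px ∷ Pxs) =
  ≤-trans (s≤s (length≤count unique (All.zipWith (λ (x≢i , Pi) → -intro P Pi (≢-sym x≢i))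
                                                  (x∉xs , Pxs))))
          (≤-reflexive (≡-sym (count-remove P Px)))

argmax : ∀ {m} (f : Fin (suc m) → ℕ) → ∃ λ x → ∀ y → f y ≤ f x
argmax {zero}  f = zero , λ { zero → ≤-refl }
argmax {suc m} f with argmax (f ∘ suc)
... | x , max with f zero ≤? f (suc x)
...   | yes f0≤ = suc x , λ { zero → f0≤ ; (suc y) → max y }
...   | no  f0≰ = zero  , λ { zero → ≤-refl ; (suc y) → ≤-trans (max y) (<⇒≤ (≰⇒> f0≰)) }

-- Maximise f + 1 on P and 0 off P; the maximum is then attained in P.
argmax-on : ∀ {m} (P : Fin m → Bool) (f : Fin m → ℕ) {a} → P a ≡ true →
  ∃ λ x → P x ≡ true × (∀ y → P y ≡ true → f y ≤ f x)
argmax-on {zero}  _ _ {()} _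
argmax-on {suc m} P f {a} Pa with argmax (λ y → if P y then suc (f y) else 0)
... | x , max with P x in Px
...   | true  = x , Px , λ y Py →
                  ≤-pred (subst (λ b → (if b then suc (f y) else 0) ≤ suc (f x)) Py (max y))
...   | false = contradiction (subst (λ b → (if b then suc (f a) else 0) ≤ 0) Pa (max a)) λ ()

≤2*∸2 : ∀ {s a b ω} → s ≤ a + b → suc a ≤ ω → suc b ≤ ω → s ≤ 2 * ω ∸ 2
≤2*∸2 {s} {a} {b} {ω} s≤a+b a<ω b<ω = m+n≤o⇒m≤o∸n s (begin
  s + 2          ≤⟨ +-mono-≤ s≤a+b ≤-refl ⟩
  a + b + 2      ≡⟨ shift a b ⟩
  suc a + suc b  ≤⟨ +-mono-≤ a<ω b<ω ⟩
  ω + ω          ≡⟨ double ω ⟩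
  2 * ω          ∎)
  where
  open ≤-Reasoning
  shift : ∀ a b → a + b + 2 ≡ suc a + suc b
  shift = solve-∀
  double : ∀ ω → ω + ω ≡ 2 * ω
  double = solve-∀

half-step : ∀ {s k c} → s ≤ c + c → k ≤ 1 → suc (s + k) ≤ suc c + suc c
half-step {c = c} s≤2c k≤1 = ≤-trans (s≤s (+-mono-≤ s≤2c k≤1)) (≤-reflexive (shift c))
  where
  shift : ∀ c → suc (c + c + 1) ≡ suc c + suc c
  shift = solve-∀

small-case : ∀ {Δ ω} → Δ ≤ 5 → 3 ≤ ω →
  (Δ ≡ 2 * ω ∸ 1 × Δ ≡ 5 × ω ≡ 3) ⊎ Δ ≤ 2 * ω ∸ 2
small-case {Δ} {ω} Δ≤5 3≤ω with ω ≟ℕ 3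
... | yes refl with Δ ≟ℕ 5
...   | yes refl = inj₁ (refl , refl , refl)
...   | no  Δ≢5  = inj₂ (≤-pred (≤∧≢⇒< Δ≤5 Δ≢5))
small-case {Δ} {ω} Δ≤5 3≤ω | no ω≢3 =
  inj₂ (≤-trans Δ≤5 (m+n≤o⇒m≤o∸n 5 (≤-trans (n≤1+n 7) (*-monoʳ-≤ 2 4≤ω))))
  where
  4≤ω : 4 ≤ ω
  4≤ω = ≤∧≢⇒< 3≤ω (ω≢3 ∘ ≡-sym)

clawAdj-sym : ∀ i j → clawAdj i j ≡ clawAdj j i
clawAdj-sym = from-yes (all? λ i → all? λ j → clawAdj i j ≟ᵇ clawAdj j i)

clawAdj-irrefl : ∀ i → clawAdj i i ≡ false
clawAdj-irrefl = from-yes (all? λ i → clawAdj i i ≟ᵇ false)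

k2k1joinK2Adj-sym : ∀ i j → k2k1joinK2Adj i j ≡ k2k1joinK2Adj j i
k2k1joinK2Adj-sym = from-yes (all? λ i → all? λ j → k2k1joinK2Adj i j ≟ᵇ k2k1joinK2Adj j i)

k2k1joinK2Adj-irrefl : ∀ i → k2k1joinK2Adj i i ≡ false
k2k1joinK2Adj-irrefl = from-yes (all? λ i → k2k1joinK2Adj i i ≟ᵇ false)

-- Cliques and neighbourhoods

module _ {n : ℕ} (G : Graph n) where

  Apart : Fin n → Fin n → Set
  Apart i j = i ≢ j × adj G i j ≡ false

  Clique : (Fin n → Bool) → Set
  Clique C = ∀ i j → C i ≡ true → C j ≡ true → i ≢ j → adj G i j ≡ true

  adjacent⇒≢ : ∀ {i j} → adj G i j ≡ true → i ≢ j
  adjacent⇒≢ {i} ij refl = not-¬ ij (irrefl G i)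

  adj-sym : ∀ {i j} → adj G i j ≡ true → adj G j i ≡ true
  adj-sym {i} {j} ij = trans (sym G j i) ij

  apart-sym : ∀ {i j} → Apart i j → Apart j i
  apart-sym {i} {j} (i≢j , ij) = ≢-sym i≢j , trans (sym G j i) ij

  nbr≢nonNbr : ∀ {x u y} → adj G x u ≡ true → adj G x y ≡ false → u ≢ y
  nbr≢nonNbr xu xy refl = not-¬ xu xy

  ⊆nbhd⇒∌ : ∀ {C a} → C ⊆ adj G a → C a ≡ false
  ⊆nbhd⇒∌ {C} {a} C⊆Na = ¬-not λ Ca → not-¬ (C⊆Na a Ca) (irrefl G a)

  clique-insert : ∀ {C a} → C ⊆ adj G a → Clique C → Clique (insert a C)
  clique-insert {C} {a} C⊆Na C-clique i j i∈ j∈ i≢j with i ≟ a | j ≟ a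
  ... | yes refl | yes refl = contradiction refl i≢j
  ... | yes refl | no _     = C⊆Na j j∈
  ... | no _     | yes refl = adj-sym (C⊆Na i i∈)
  ... | no _     | no _     = C-clique i j i∈ j∈ i≢j

  clique-or-apart-pair : ∀ C → Clique C ⊎ ∃₂ λ u w → C u ≡ true × C w ≡ true × Apart u w
  clique-or-apart-pair C
    with any? (λ u → any? (λ w →
           C u ≟ᵇ true ×-dec C w ≟ᵇ true ×-dec ¬? (u ≟ w) ×-dec adj G u w ≟ᵇ false))
  ... | yes (u , w , pair) = inj₂ (u , w , pair)
  ... | no  none           = inj₁ λ i j Ci Cj i≢j → ¬-not λ ij → none (i , j , Ci , Cj , i≢j , ij)

  count-split-at : ∀ S {a} → S a ≡ true →
    count S ≡ suc (count (S ∩ adj G a) + count (S - a ∖ adj G a))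
  count-split-at S {a} Sa = begin
    count S                                           ≡⟨ count-remove S Sa ⟩
    suc (count (S - a))                               ≡⟨ cong suc (count-split (S - a) (adj G a)) ⟩
    suc (count (S - a ∩ adj G a) + count non-nbrs)    ≡⟨ cong (λ k → suc (k + count non-nbrs))
                                                                (count-cong drop-a) ⟩
    suc (count (S ∩ adj G a) + count non-nbrs)        ∎
    where
    open ≡-Reasoning
    non-nbrs = S - a ∖ adj G a
    drop-a : ∀ i → (S - a ∩ adj G a) i ≡ (S ∩ adj G a) i
    drop-a i with i ≟ a
    ... | yes refl rewrite irrefl G i = trans (∧-zeroʳ _) (≡-sym (∧-zeroʳ _))
    ... | no _     = cong (_∧ adj G a i) (∧-identityʳ (S i))

  -- Greedy: keep a vertex a and recurse into its neighbours; only a and its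
  -- at most one non-neighbour are discarded.
  half-clique : ∀ fuel S → count S ≤ fuel → (∀ a → S a ≡ true → count (S - a ∖ adj G a) ≤ 1) →
    ∃ λ C → C ⊆ S × Clique C × count S ≤ count C + count C
  half-clique zero S S≤0 _ = ∅ , (λ _ ()) , (λ _ _ ()) , ≤-trans S≤0 z≤n
  half-clique (suc fuel) S S≤ few with member-or-count≡0 S
  ... | inj₂ S≡0 = ∅ , (λ _ ()) , (λ _ _ ()) , ≤-trans (≤-reflexive S≡0) z≤n
  ... | inj₁ (a , Sa)
    with half-clique fuel (S ∩ adj G a)
           (≤-pred (≤-trans (s≤s (m≤m+n _ _)) (subst (_≤ suc fuel) (count-split-at S Sa) S≤)))
           (λ b Sab → ≤-trans (count-mono (-∖-mono (P∩Q⊆P S (adj G a))))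
                               (few b (P∩Q⊆P S (adj G a) b Sab)))
  ... | C , C⊆Sa , C-clique , Sa≤2C = insert a C , insert⊆ Sa (⊆-trans C⊆Sa (P∩Q⊆P S (adj G a))) ,
                                        clique-insert C⊆Na C-clique , bound
    where
    C⊆Na : C ⊆ adj G a
    C⊆Na = ⊆-trans C⊆Sa (P∩Q⊆Q S (adj G a))
    bound : count S ≤ count (insert a C) + count (insert a C)
    bound = begin
      count S                                                ≡⟨ count-split-at S Sa ⟩
      suc (count (S ∩ adj G a) + count (S - a ∖ adj G a))    ≤⟨ half-step Sa≤2C (few a Sa) ⟩
      suc (count C) + suc (count C)                          ≡⟨ ≡-sym (cong₂ _+_ C+a C+a) ⟩
      count (insert a C) + count (insert a C)                ∎
      where
      open ≤-Reasoning
      C+a = count-insert C (⊆nbhd⇒∌ C⊆Na)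


  Matches : ∀ {k} → (Fin k → Fin k → Bool) → (Fin k → Fin n) → Fin k → Fin k → Set
  Matches h f i j = f i ≢ f j × adj G (f i) (f j) ≡ h i j

  induced-from-upper : ∀ {k} {h : Fin k → Fin k → Bool} →
    (∀ i j → h i j ≡ h j i) → (∀ i → h i i ≡ false) →
    (f : Fin k → Fin n) → (∀ i j → i <ᶠ j → Matches h f i j) → ContainsInduced h G
  induced-from-upper {h = h} h-sym h-irrefl f upper = f , injective , agrees
    where
    injective : Injective _≡_ _≡_ f
    injective {i} {j} fi≡fj with <-cmp i j
    ... | tri< i<j _ _ = contradiction fi≡fj (proj₁ (upper i j i<j))
    ... | tri≈ _ i≡j _ = i≡j
    ... | tri> _ _ j<i = contradiction (≡-sym fi≡fj) (proj₁ (upper j i j<i))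
    agrees : ∀ i j → adj G (f i) (f j) ≡ h i j
    agrees i j with <-cmp i j
    ... | tri< i<j _ _  = proj₂ (upper i j i<j)
    ... | tri≈ _ refl _ = trans (irrefl G (f i)) (≡-sym (h-irrefl i))
    ... | tri> _ _ j<i  = trans (sym G (f i) (f j)) (trans (proj₂ (upper j i j<i)) (h-sym j i))

  distinct-adjacent : ∀ {i j} → adj G i j ≡ true → i ≢ j × adj G i j ≡ true
  distinct-adjacent ij = adjacent⇒≢ ij , ij

  claw-free⇒nonNbrs-adjacent : ¬ ContainsInduced clawAdj G → ∀ {v a b c} →
    adj G v a ≡ true → adj G v b ≡ true → adj G v c ≡ true →
    Apart a b → Apart a c → b ≢ c → adj G b c ≡ true
  claw-free⇒nonNbrs-adjacent claw-free {v} {a} {b} {c} va vb vc ab ac b≢c =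
    ¬-not λ bc → claw-free (induced-from-upper clawAdj-sym clawAdj-irrefl claw (upper bc))
    where
    claw : Fin 4 → Fin n
    claw = lookup (v ∷ a ∷ b ∷ c ∷ [])
    upper : adj G b c ≡ false → ∀ i j → i <ᶠ j → Matches clawAdj claw i j
    upper _  zero             (suc zero)             _ = distinct-adjacent va
    upper _  zero             (suc (suc zero))       _ = distinct-adjacent vb
    upper _  zero             (suc (suc (suc zero))) _ = distinct-adjacent vc
    upper _  (suc zero)       (suc (suc zero))       _ = ab
    upper _  (suc zero)       (suc (suc (suc zero))) _ = ac
    upper bc (suc (suc zero)) (suc (suc (suc zero))) _ = b≢c , bc
    upper _  _                     zero                   ()
    upper _  (suc _)               (suc zero)             (s≤s ())
    upper _  (suc (suc _))         (suc (suc zero))       (s≤s (s≤s ()))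
    upper _  (suc (suc (suc _)))   (suc (suc (suc zero))) (s≤s (s≤s (s≤s ())))

  nbr-sees-one-nonNbr : ¬ ContainsInduced clawAdj G → ¬ ContainsInduced k2k1joinK2Adj G →
    ∀ {v x u y₁ y₂} →
    adj G v x ≡ true → adj G v u ≡ true → adj G v y₁ ≡ true → adj G v y₂ ≡ true →
    adj G x u ≡ true → Apart x y₁ → Apart x y₂ → y₁ ≢ y₂ →
    adj G u y₁ ≡ true → adj G u y₂ ≡ true → ⊥
  nbr-sees-one-nonNbr claw-free k-free {v} {x} {u} {y₁} {y₂}
                      vx vu vy₁ vy₂ xu xy₁ xy₂ y₁≢y₂ uy₁ uy₂ =
    k-free (induced-from-upper k2k1joinK2Adj-sym k2k1joinK2Adj-irrefl copy upper)
    where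
    -- y₁ y₂ x v u take the roles of a b c d e.
    copy : Fin 5 → Fin n
    copy = lookup (y₁ ∷ y₂ ∷ x ∷ v ∷ u ∷ [])
    upper : ∀ i j → i <ᶠ j → Matches k2k1joinK2Adj copy i j
    upper zero (suc zero) _ =
      y₁≢y₂ , claw-free⇒nonNbrs-adjacent claw-free vx vy₁ vy₂ xy₁ xy₂ y₁≢y₂
    upper zero                   (suc (suc zero))             _ = apart-sym xy₁
    upper zero                   (suc (suc (suc zero)))       _ = distinct-adjacent (adj-sym vy₁)
    upper zero                   (suc (suc (suc (suc zero)))) _ = distinct-adjacent (adj-sym uy₁)
    upper (suc zero)             (suc (suc zero))             _ = apart-sym xy₂
    upper (suc zero)             (suc (suc (suc zero)))       _ = distinct-adjacent (adj-sym vy₂)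
    upper (suc zero)             (suc (suc (suc (suc zero)))) _ = distinct-adjacent (adj-sym uy₂)
    upper (suc (suc zero))       (suc (suc (suc zero)))       _ = distinct-adjacent (adj-sym vx)
    upper (suc (suc zero))       (suc (suc (suc (suc zero)))) _ = distinct-adjacent xu
    upper (suc (suc (suc zero))) (suc (suc (suc (suc zero)))) _ = distinct-adjacent vu
    upper _                         zero                         ()
    upper (suc _)                   (suc zero)                   (s≤s ())
    upper (suc (suc _))             (suc (suc zero))             (s≤s (s≤s ()))
    upper (suc (suc (suc _)))       (suc (suc (suc zero)))       (s≤s (s≤s (s≤s ())))
    upper (suc (suc (suc (suc _)))) (suc (suc (suc (suc zero)))) (s≤s (s≤s (s≤s (s≤s ()))))

  module Neighbourhood
    (claw-free : ¬ ContainsInduced clawAdj G) (k-free : ¬ ContainsInduced k2k1joinK2Adj G)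
    {ω : ℕ} (clique≤ω : ∀ C → Clique C → count C ≤ ω) (v : Fin n) where

    N : Fin n → Fin n → Bool
    N = adj G

    nbrs nonNbrs : Fin n → Fin n → Bool
    nbrs    y = N v ∩ N y
    nonNbrs y = N v - y ∖ N y

    cone : ∀ {C} → C ⊆ N v → Clique C → suc (count C) ≤ ω
    cone {C} C⊆Nv C-clique =
      subst (_≤ ω) (count-insert C (⊆nbhd⇒∌ C⊆Nv)) (clique≤ω _ (clique-insert C⊆Nv C-clique))

    edge⇒3≤ω : ∀ {a b} → N v a ≡ true → N v b ≡ true → adj G a b ≡ true → 3 ≤ ω
    edge⇒3≤ω {a} {b} va vb ab =
      subst (λ k → suc k ≤ ω) two
        (cone (insert⊆ va (insert⊆ vb λ _ ())) (clique-insert b⊆Na (clique-insert (λ _ ()) λ _ _ ())))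
      where
      b⊆Na : insert b ∅ ⊆ N a
      b⊆Na = insert⊆ ab λ _ ()
      two : count (insert a (insert b ∅)) ≡ 2
      two = trans (count-insert (insert b ∅) (⊆nbhd⇒∌ b⊆Na))
                  (cong suc (trans (count-insert ∅ {b} refl) (cong suc (count-none {n} {∅} λ _ → refl))))

    nbr∈Nv : ∀ {y z} → nbrs y z ≡ true → N v z ≡ true
    nbr∈Nv {y} = P∩Q⊆P (N v) (N y) _

    nbr-adj : ∀ {y z} → nbrs y z ≡ true → adj G y z ≡ true
    nbr-adj {y} = P∩Q⊆Q (N v) (N y) _

    nonNbr-intro : ∀ {y z} → N v z ≡ true → Apart y z → nonNbrs y z ≡ true
    nonNbr-intro {y} vz (y≢z , yz) = ∖-intro (N v - y) (N y) (-intro (N v) vz (≢-sym y≢z)) yz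

    nonNbr∈Nv : ∀ {y z} → nonNbrs y z ≡ true → N v z ≡ true
    nonNbr∈Nv {y} yz = proj₁ (-elim (N v) (proj₁ (∖-elim (N v - y) (N y) yz)))

    nonNbr-apart : ∀ {y z} → nonNbrs y z ≡ true → Apart y z
    nonNbr-apart {y} yz =
      ≢-sym (proj₂ (-elim (N v) (proj₁ (∖-elim (N v - y) (N y) yz)))) ,
      proj₂ (∖-elim (N v - y) (N y) yz)

    nonNbrs-clique : ∀ {y} → N v y ≡ true → Clique (nonNbrs y)
    nonNbrs-clique vy i j yi yj i≢j =
      claw-free⇒nonNbrs-adjacent claw-free vy (nonNbr∈Nv yi) (nonNbr∈Nv yj)
        (nonNbr-apart yi) (nonNbr-apart yj) i≢j

    bound-if-nbrs-clique : ∀ {x} → N v x ≡ true → Clique (nbrs x) → count (N v) ≤ 2 * ω ∸ 2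
    bound-if-nbrs-clique {x} vx nbrs-clique =
      ≤2*∸2 (≤-reflexive (count-split-at (N v) vx)) x+nbrs<ω (cone nonNbrs⊆Nv (nonNbrs-clique vx))
      where
      nbrs⊆Nx : nbrs x ⊆ N x
      nbrs⊆Nx _ = nbr-adj
      x+nbrs<ω : suc (suc (count (nbrs x))) ≤ ω
      x+nbrs<ω = subst (λ k → suc k ≤ ω) (count-insert (nbrs x) (⊆nbhd⇒∌ nbrs⊆Nx))
                   (cone (insert⊆ vx λ _ → nbr∈Nv) (clique-insert nbrs⊆Nx nbrs-clique))
      nonNbrs⊆Nv : nonNbrs x ⊆ N v
      nonNbrs⊆Nv _ = nonNbr∈Nv

    bound-if-few-nonNbrs : (∀ y → N v y ≡ true → count (nonNbrs y) ≤ 1) → count (N v) ≤ 2 * ω ∸ 2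
    bound-if-few-nonNbrs few with half-clique (count (N v)) (N v) ≤-refl few
    ... | C , C⊆Nv , C-clique , Nv≤2C = ≤2*∸2 Nv≤2C (cone C⊆Nv C-clique) (cone C⊆Nv C-clique)

    module MaxNonNbrs {x} (vx : N v x ≡ true)
      (x-max : ∀ y → N v y ≡ true → count (nonNbrs y) ≤ count (nonNbrs x)) where

      sees-at-most-one : ∀ {p y₁ y₂} → nbrs x p ≡ true →
        nonNbrs x y₁ ≡ true → nonNbrs x y₂ ≡ true → y₁ ≢ y₂ →
        adj G p y₁ ≡ true → adj G p y₂ ≡ true → ⊥
      sees-at-most-one xp xy₁ xy₂ =
        nbr-sees-one-nonNbr claw-free k-free vx (nbr∈Nv xp) (nonNbr∈Nv xy₁) (nonNbr∈Nv xy₂)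
          (nbr-adj xp) (nonNbr-apart xy₁) (nonNbr-apart xy₂)

      sees-one-of : ∀ {u w y} → nbrs x u ≡ true → nbrs x w ≡ true → Apart u w →
        nonNbrs x y ≡ true → adj G u y ≡ false → adj G w y ≡ true
      sees-one-of xu xw uw xy uy =
        claw-free⇒nonNbrs-adjacent claw-free (nbr∈Nv xu) (nbr∈Nv xw) (nonNbr∈Nv xy) uw
          (nbr≢nonNbr (nbr-adj xu) x≁y , uy) (nbr≢nonNbr (nbr-adj xw) x≁y)
        where
        x≁y = proj₂ (nonNbr-apart xy)

      x∈nonNbrs : ∀ {y} → nonNbrs x y ≡ true → nonNbrs y x ≡ true
      x∈nonNbrs xy = nonNbr-intro vx (apart-sym (nonNbr-apart xy))

      missed-nonNbr : ∀ {p y} → nbrs x p ≡ true → nonNbrs x y ≡ true → adj G p y ≡ false →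
        nonNbrs y p ≡ true
      missed-nonNbr xp xy py =
        nonNbr-intro (nbr∈Nv xp) (apart-sym (nbr≢nonNbr (nbr-adj xp) (proj₂ (nonNbr-apart xy)) , py))

      -- x u y₂ y₁ w is an induced 5-cycle in G[N v].
      module FiveCycle {u w y₁ y₂}
        (xu : nbrs x u ≡ true) (xw : nbrs x w ≡ true) (uw : Apart u w)
        (xy₁ : nonNbrs x y₁ ≡ true) (xy₂ : nonNbrs x y₂ ≡ true) (y₁≢y₂ : y₁ ≢ y₂)
        (uy₁ : adj G u y₁ ≡ false) (uy₂ : adj G u y₂ ≡ true)
        (wy₁ : adj G w y₁ ≡ true) (wy₂ : adj G w y₂ ≡ false) where

        nonNbrs-x⊆ : ∀ z → nonNbrs x z ≡ true → z ∈ y₁ ∷ y₂ ∷ []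
        nonNbrs-x⊆ z xz with z ≟ y₁ | z ≟ y₂
        ... | yes z≡y₁ | _        = here z≡y₁
        ... | no _     | yes z≡y₂ = there (here z≡y₂)
        ... | no z≢y₁  | no z≢y₂ with adj G u z in uz
        ...   | true  = ⊥-elim (sees-at-most-one xu xy₂ xz (≢-sym z≢y₂) uy₂ uz)
        ...   | false =
          ⊥-elim (sees-at-most-one xw xy₁ xz (≢-sym z≢y₁) wy₁ (sees-one-of xu xw uw xz uz))

        no-three-nonNbrs : ∀ {y a b c} → N v y ≡ true →
          nonNbrs y a ≡ true → nonNbrs y b ≡ true → nonNbrs y c ≡ true →
          a ≢ b → a ≢ c → b ≢ c → ⊥
        no-three-nonNbrs {y} vy ya yb yc a≢b a≢c b≢c =
          contradiction (≤-trans three (≤-trans (x-max y vy) two)) λ { (s≤s (s≤s ())) }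
          where
          three = length≤count ((a≢b ∷ a≢c ∷ []) ∷ (b≢c ∷ []) ∷ [] ∷ []) (ya ∷ yb ∷ yc ∷ [])
          two   = count≤length (y₁ ∷ y₂ ∷ []) nonNbrs-x⊆

        no-other-nbr : ∀ {z} → nbrs x z ≡ true → z ≢ u → z ≢ w → ⊥
        no-other-nbr {z} xz z≢u z≢w with adj G z y₁ in zy₁ | adj G z y₂ in zy₂
        ... | true  | true  = sees-at-most-one xz xy₁ xy₂ y₁≢y₂ zy₁ zy₂
        ... | false | _     = no-three-nonNbrs (nonNbr∈Nv xy₁)
                                (x∈nonNbrs xy₁) (missed-nonNbr xu xy₁ uy₁) (missed-nonNbr xz xy₁ zy₁)
                                (adjacent⇒≢ (nbr-adj xu)) (adjacent⇒≢ (nbr-adj xz)) (≢-sym z≢u)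
        ... | true  | false = no-three-nonNbrs (nonNbr∈Nv xy₂)
                                (x∈nonNbrs xy₂) (missed-nonNbr xw xy₂ wy₂) (missed-nonNbr xz xy₂ zy₂)
                                (adjacent⇒≢ (nbr-adj xw)) (adjacent⇒≢ (nbr-adj xz)) (≢-sym z≢w)

        Nv⊆ : ∀ z → N v z ≡ true → z ∈ x ∷ u ∷ w ∷ y₁ ∷ y₂ ∷ []
        Nv⊆ z vz with z ≟ x
        ... | yes z≡x = here z≡x
        ... | no z≢x with adj G x z in xz
        ...   | false = there (there (there (nonNbrs-x⊆ z (nonNbr-intro vz (≢-sym z≢x , xz)))))
        ...   | true with z ≟ u | z ≟ w
        ...     | yes z≡u | _       = there (here z≡u)
        ...     | no _    | yes z≡w = there (there (here z≡w))
        ...     | no z≢u  | no z≢w  = ⊥-elim (no-other-nbr (∩-intro (N v) (N x) vz xz) z≢u z≢w)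

        five-vertices : count (N v) ≤ 5 × 3 ≤ ω
        five-vertices = count≤length _ Nv⊆ , edge⇒3≤ω vx (nbr∈Nv xu) (nbr-adj xu)

      bound-if-apart-nbrs : ∀ {u w} → nbrs x u ≡ true → nbrs x w ≡ true → Apart u w →
        2 ≤ count (nonNbrs x) → count (N v) ≤ 5 × 3 ≤ ω
      -- Each yᵢ sees u or w, and neither u nor w sees both, so u, w and y₁, y₂
      -- are matched by the edges between them.
      bound-if-apart-nbrs {u} {w} xu xw uw 2≤ with 2≤count⇒pair 2≤
      ... | y₁ , y₂ , xy₁ , xy₂ , y₁≢y₂
        with adj G u y₁ in uy₁ | adj G u y₂ in uy₂ | adj G w y₁ in wy₁ | adj G w y₂ in wy₂
      ... | true  | true  | _     | _     = ⊥-elim (sees-at-most-one xu xy₁ xy₂ y₁≢y₂ uy₁ uy₂)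
      ... | _     | _     | true  | true  = ⊥-elim (sees-at-most-one xw xy₁ xy₂ y₁≢y₂ wy₁ wy₂)
      ... | false | _     | false | _     = ⊥-elim (not-¬ (sees-one-of xu xw uw xy₁ uy₁) wy₁)
      ... | _     | false | _     | false = ⊥-elim (not-¬ (sees-one-of xu xw uw xy₂ uy₂) wy₂)
      ... | false | true  | true  | false =
        FiveCycle.five-vertices xu xw uw xy₁ xy₂ y₁≢y₂ uy₁ uy₂ wy₁ wy₂
      ... | true  | false | false | true  =
        FiveCycle.five-vertices xu xw uw xy₂ xy₁ (≢-sym y₁≢y₂) uy₂ uy₁ wy₂ wy₁

    nbhd-bound : count (N v) ≤ 2 * ω ∸ 2 ⊎ (count (N v) ≤ 5 × 3 ≤ ω)
    nbhd-bound with member-or-count≡0 (N v)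
    ... | inj₂ Nv≡0 = inj₁ (≤-trans (≤-reflexive Nv≡0) z≤n)
    ... | inj₁ (_ , va) with argmax-on (N v) (count ∘ nonNbrs) va
    ...   | x , vx , x-max with clique-or-apart-pair (nbrs x)
    ...     | inj₁ nbrs-clique = inj₁ (bound-if-nbrs-clique vx nbrs-clique)
    ...     | inj₂ (u , w , xu , xw , uw) with count (nonNbrs x) ≤? 1
    ...       | yes ≤1 = inj₁ (bound-if-few-nonNbrs λ y vy → ≤-trans (x-max y vy) ≤1)
    ...       | no  ≰1 = inj₂ (MaxNonNbrs.bound-if-apart-nbrs vx x-max xu xw uw (≰⇒> ≰1))

degree≡count : ∀ {n} (G : Graph n) v → degree G v ≡ count (adj G v)
degree≡count G v = filter-tabulate (adj G v) (λ i → i)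
  where
  filter-tabulate : ∀ {m} {A : Set} (P : A → Bool) (f : Fin m → A) →
    length (filterᵇ P (tabulate f)) ≡ count (P ∘ f)
  filter-tabulate {zero}  P f = refl
  filter-tabulate {suc m} P f with P (f zero)
  ... | true  = cong suc (filter-tabulate P (f ∘ suc))
  ... | false = filter-tabulate P (f ∘ suc)

clique≤ω : ∀ {n} {G : Graph n} {ω} → IsCliqueNumber G ω → ∀ C → Clique G C → count C ≤ ω
clique≤ω {G = G} {ω} (_ , maximum) C C-clique =
  subst (_≤ ω) (size-tabulate C)
    (maximum (Vec.tabulate C) λ i j i∈ j∈ → C-clique i j (∈-tabulate i∈) (∈-tabulate j∈))
  where
  ∈-tabulate : ∀ {i} → i Subset.∈ Vec.tabulate C → C i ≡ true
  ∈-tabulate {i} i∈ = trans (≡-sym (lookup∘tabulate C i)) ([]=⇒lookup i∈)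
  size-tabulate : ∀ {m} (P : Fin m → Bool) → Subset.∣ Vec.tabulate P ∣ ≡ count P
  size-tabulate {zero}  P = refl
  size-tabulate {suc m} P with P zero
  ... | true  = cong suc (size-tabulate (P ∘ suc))
  ... | false = size-tabulate (P ∘ suc)

dichotomy : ∀ {Δ ω} → Δ ≤ 2 * ω ∸ 2 ⊎ (Δ ≤ 5 × 3 ≤ ω) →
  (Δ ≡ 2 * ω ∸ 1 × Δ ≡ 5 × ω ≡ 3) ⊎ Δ ≤ 2 * ω ∸ 2
dichotomy (inj₁ Δ≤)          = inj₂ Δ≤
dichotomy (inj₂ (Δ≤5 , 3≤ω)) = small-case Δ≤5 3≤ω

corollary1 : ∀ {n} (G : Graph (suc n)) (Δ ω : ℕ) →
    ClawK2K1K2Free G → IsMaxDegree G Δ → IsCliqueNumber G ω →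
    (Δ ≤ 2 * ω ∸ 1) ×
    ((Δ ≡ 2 * ω ∸ 1 × Δ ≡ 5 × ω ≡ 3) ⊎ (Δ ≤ 2 * ω ∸ 2))
corollary1 G Δ ω (claw-free , k-free) ((v , deg-v≡Δ) , _) is-ω = Δ≤2ω∸1 cases , cases
  where
  open Neighbourhood G claw-free k-free (clique≤ω {G = G} is-ω) v
  cases : (Δ ≡ 2 * ω ∸ 1 × Δ ≡ 5 × ω ≡ 3) ⊎ Δ ≤ 2 * ω ∸ 2
  cases = dichotomy (subst (λ d → d ≤ 2 * ω ∸ 2 ⊎ (d ≤ 5 × 3 ≤ ω))
                           (trans (≡-sym (degree≡count G v)) deg-v≡Δ) nbhd-bound)
  Δ≤2ω∸1 : (Δ ≡ 2 * ω ∸ 1 × Δ ≡ 5 × ω ≡ 3) ⊎ Δ ≤ 2 * ω ∸ 2 → Δ ≤ 2 * ω ∸ 1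
  Δ≤2ω∸1 (inj₁ (Δ≡ , _)) = ≤-reflexive Δ≡
  Δ≤2ω∸1 (inj₂ Δ≤)       = ≤-trans Δ≤ (∸-monoʳ-≤ (2 * ω) (n≤1+n 1))
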